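{- Let $G$ and $H$ be countable groups such that $H$ is homogeneous. Then $G$ can be embedded into $H$ if and only if every finitely generated subgroup of $G$ can be embedded into $H$.
   Context: A countably infinite group $H$ is homogeneous if every isomorphism between two finitely generated subgroups of $H$ extends to an automorphism of $H$. -}

module Defs where

open import Level using (Level; _⊔_)
open import Algebra.Bundles using (Group)
open import Algebra.Structures using (IsGroup)
open import Algebra.Morphism.Structures using (module GroupMorphisms)
open import Data.Nat using (ℕ)
open import Data.List using (List)
open import Data.List.Membership.Propositional using (_∈_)
open import Data.Product using (Σ; Σ-syntax; ∃; ∃-syntax; _×_; _,_; proj₁; proj₂)
open import Relation.Binary.PropositionalEquality using (_≡_)
open import Function.Bundles using (_⇔_)

private
  variable
    c ℓ c₁ ℓ₁ c₂ ℓ₂ : Level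

module _ (G : Group c ℓ) where
  open Group G

  data ⟨_⟩ (xs : List Carrier) : Carrier → Set (c ⊔ ℓ) where
    gen  : ∀ {x} → x ∈ xs → ⟨ xs ⟩ x
    unit : ⟨ xs ⟩ ε
    inv  : ∀ {x} → ⟨ xs ⟩ x → ⟨ xs ⟩ (x ⁻¹)
    mul  : ∀ {x y} → ⟨ xs ⟩ x → ⟨ xs ⟩ y → ⟨ xs ⟩ (x ∙ y)
    resp : ∀ {x y} → x ≈ y → ⟨ xs ⟩ x → ⟨ xs ⟩ y

  FGSubgroup : List Carrier → Group (c ⊔ ℓ) ℓ
  FGSubgroup xs = record
    { Carrier = Σ Carrier ⟨ xs ⟩
    ; _≈_ = λ a b → proj₁ a ≈ proj₁ b
    ; _∙_ = λ a b → (proj₁ a ∙ proj₁ b) , mul (proj₂ a) (proj₂ b)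
    ; ε = ε , unit
    ; _⁻¹ = λ a → (proj₁ a ⁻¹) , inv (proj₂ a)
    ; isGroup = record
      { isMonoid = record
        { isSemigroup = record
          { isMagma = record
            { isEquivalence = record { refl = refl ; sym = sym ; trans = trans }
            ; ∙-cong = ∙-cong
            }
          ; assoc = λ a b d → assoc (proj₁ a) (proj₁ b) (proj₁ d)
          }
        ; identity = (λ a → identityˡ (proj₁ a)) , (λ a → identityʳ (proj₁ a))
        }
      ; inverse = (λ a → inverseˡ (proj₁ a)) , (λ a → inverseʳ (proj₁ a))
      ; ⁻¹-cong = ⁻¹-cong
      }
    }

IsEmbedding : (G : Group c₁ ℓ₁) (H : Group c₂ ℓ₂) →
              (Group.Carrier G → Group.Carrier H) → Set (c₁ ⊔ ℓ₁ ⊔ ℓ₂)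
IsEmbedding G H f = GroupMorphisms.IsGroupMonomorphism (Group.rawGroup G) (Group.rawGroup H) f

Embeds : (G : Group c₁ ℓ₁) (H : Group c₂ ℓ₂) → Set (c₁ ⊔ c₂ ⊔ ℓ₁ ⊔ ℓ₂)
Embeds G H = Σ (Group.Carrier G → Group.Carrier H) (IsEmbedding G H)

IsIsomorphism : (G : Group c₁ ℓ₁) (H : Group c₂ ℓ₂) →
                (Group.Carrier G → Group.Carrier H) → Set (c₁ ⊔ c₂ ⊔ ℓ₁ ⊔ ℓ₂)
IsIsomorphism G H f = GroupMorphisms.IsGroupIsomorphism (Group.rawGroup G) (Group.rawGroup H) f

-- Countable group: its elements can be enumerated by ℕ (a group is nonempty,
-- so this covers both finite and countably infinite groups).
Countable : Group c ℓ → Set (c ⊔ ℓ)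
Countable G = Σ[ e ∈ (ℕ → Carrier) ] (∀ g → ∃[ n ] e n ≈ g)
  where open Group G

CountablyInfinite : Group c ℓ → Set (c ⊔ ℓ)
CountablyInfinite G =
  Σ[ e ∈ (ℕ → Carrier) ] ((∀ m n → e m ≈ e n → m ≡ n) × (∀ g → ∃[ n ] e n ≈ g))
  where open Group G

Homogeneous : Group c ℓ → Set (c ⊔ ℓ)
Homogeneous H =
  CountablyInfinite H ×
  (∀ (xs ys : List Carrier)
     (f : Group.Carrier (FGSubgroup H xs) → Group.Carrier (FGSubgroup H ys)) →
     IsIsomorphism (FGSubgroup H xs) (FGSubgroup H ys) f →
     Σ[ α ∈ (Carrier → Carrier) ]
       (IsIsomorphism H H α × (∀ a → α (proj₁ a) ≈ proj₁ (f a))))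
  where open Group H

{-# OPTIONS --safe #-}
module Submission where

-- Enumerate G and let Gₙ be the subgroup generated by its first n elements.
-- Any two embeddings of a finitely generated group into H differ by an
-- automorphism of H: each is an isomorphism onto the subgroup generated by the
-- images of the generators, and homogeneity extends the isomorphism between
-- these two images. So the given embedding of Gₙ₊₁ can be corrected to extend
-- the one already chosen on Gₙ, and the union of this chain embeds G.

open import Defs
open import Level using (Level)
open import Algebra.Bundles using (Group)
open import Algebra.Morphism.Structures using (module GroupMorphisms)
open import Algebra.Morphism.Consequences using (homomorphic₂-inj)
import Algebra.Morphism.Construct.Composition as Compose
open import Function.Base using (id; _∘_)
open import Function.Bundles using (_⇔_; mk⇔)
open import Function.Definitions using (StrictlyInverseˡ; StrictlyInverseʳ)
open import Data.List using (List; []; _∷_)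
open import Data.List.Membership.Propositional using (mapWith∈)
open import Data.List.Relation.Unary.Any using (here; there)
open import Data.List.Relation.Unary.Any.Properties using (mapWith∈⁺; mapWith∈⁻)
open import Data.List.Relation.Binary.Subset.Propositional using (_⊆_)
open import Data.Nat using (ℕ; zero; suc; _⊔_; _≤′_; ≤′-refl; ≤′-step)
open import Data.Nat.Properties using (m≤m⊔n; m≤n⊔m; ≤⇒≤′)
open import Data.Product using (Σ-syntax; ∃; _×_; _,_; proj₁; proj₂)
import Relation.Binary.PropositionalEquality as ≡
import Relation.Binary.Reasoning.Setoid as SetoidReasoning

open GroupMorphisms using (IsGroupHomomorphism; IsGroupMonomorphism; IsGroupIsomorphism)

private
  variable
    c ℓ c₁ ℓ₁ c₂ ℓ₂ : Level

module _ (A : Group c₁ ℓ₁) (B : Group c₂ ℓ₂) where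
  private
    module A = Group A
    module B = Group B

  mkIsEmbedding : (h : A.Carrier → B.Carrier) →
    (∀ {x y} → x A.≈ y → h x B.≈ h y) →
    (∀ x y → h (x A.∙ y) B.≈ h x B.∙ h y) →
    h A.ε B.≈ B.ε →
    (∀ x → h (x A.⁻¹) B.≈ h x B.⁻¹) →
    (∀ {x y} → h x B.≈ h y → x A.≈ y) →
    IsEmbedding A B h
  mkIsEmbedding h cong homo ε-homo ⁻¹-homo injective = record
    { isGroupHomomorphism = record
      { isMonoidHomomorphism = record
        { isMagmaHomomorphism = record
          { isRelHomomorphism = record { cong = cong }
          ; homo = homo }
        ; ε-homo = ε-homo }
      ; ⁻¹-homo = ⁻¹-homo }
    ; injective = injective }

module _ (A : Group c₁ ℓ₁) (B : Group c₂ ℓ₂) {h : Group.Carrier A → Group.Carrier B}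
         (h-iso : IsIsomorphism A B h) where
  private
    module A = Group A
    module B = Group B
    module h = IsGroupIsomorphism h-iso
    open SetoidReasoning B.setoid

  inverse : B.Carrier → A.Carrier
  inverse b = proj₁ (h.surjective b)

  inverse-strictlyInverseˡ : StrictlyInverseˡ B._≈_ h inverse
  inverse-strictlyInverseˡ b = proj₂ (h.surjective b) A.refl

  inverse-strictlyInverseʳ : StrictlyInverseʳ A._≈_ h inverse
  inverse-strictlyInverseʳ a = h.injective (inverse-strictlyInverseˡ (h a))

  inverse-isIsomorphism : IsIsomorphism B A inverse
  inverse-isIsomorphism = record
    { isGroupMonomorphism = mkIsEmbedding B A inverse
        (λ {b} {b′} b≈b′ → h.injective (begin
          h (inverse b)   ≈⟨ inverse-strictlyInverseˡ b ⟩
          b               ≈⟨ b≈b′ ⟩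
          b′              ≈⟨ inverse-strictlyInverseˡ b′ ⟨
          h (inverse b′)  ∎))
        (homomorphic₂-inj A.magma B.magma h.injective (λ {b} → proj₂ (h.surjective b)) h.∙-homo)
        (h.injective (begin
          h (inverse B.ε)  ≈⟨ inverse-strictlyInverseˡ B.ε ⟩
          B.ε              ≈⟨ h.ε-homo ⟨
          h A.ε            ∎))
        (λ b → h.injective (begin
          h (inverse (b B.⁻¹))  ≈⟨ inverse-strictlyInverseˡ (b B.⁻¹) ⟩
          b B.⁻¹                ≈⟨ B.⁻¹-cong (inverse-strictlyInverseˡ b) ⟨
          h (inverse b) B.⁻¹    ≈⟨ h.⁻¹-homo (inverse b) ⟨
          h (inverse b A.⁻¹)    ∎))
        (λ {b} {b′} eq → begin
          b               ≈⟨ inverse-strictlyInverseˡ b ⟨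
          h (inverse b)   ≈⟨ h.⟦⟧-cong eq ⟩
          h (inverse b′)  ≈⟨ inverse-strictlyInverseˡ b′ ⟩
          b′              ∎)
    ; surjective = λ a → h a , λ {b} b≈ha → h.injective (B.trans (inverse-strictlyInverseˡ b) b≈ha)
    }

module _ (G : Group c ℓ) where
  open Group G

  ⟨⟩-mono : ∀ {xs ys} → xs ⊆ ys → ∀ {x} → ⟨_⟩ G xs x → ⟨_⟩ G ys x
  ⟨⟩-mono xs⊆ys (gen x∈xs)   = gen (xs⊆ys x∈xs)
  ⟨⟩-mono xs⊆ys unit         = unit
  ⟨⟩-mono xs⊆ys (inv p)      = inv (⟨⟩-mono xs⊆ys p)
  ⟨⟩-mono xs⊆ys (mul p q)    = mul (⟨⟩-mono xs⊆ys p) (⟨⟩-mono xs⊆ys q)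
  ⟨⟩-mono xs⊆ys (resp x≈y p) = resp x≈y (⟨⟩-mono xs⊆ys p)

  proj₁-isEmbedding : ∀ {xs} → IsEmbedding (FGSubgroup G xs) G proj₁
  proj₁-isEmbedding = mkIsEmbedding (FGSubgroup G _) G proj₁ id (λ _ _ → refl) refl (λ _ → refl) id

module _ (K : Group c₁ ℓ₁) (H : Group c₂ ℓ₂) {h : Group.Carrier K → Group.Carrier H}
         (h-emb : IsEmbedding K H h) where
  private module h = IsGroupMonomorphism h-emb

  corestrict-isEmbedding : ∀ {ys} (h∈⟨ys⟩ : ∀ a → ⟨_⟩ H ys (h a)) →
                           IsEmbedding K (FGSubgroup H ys) (λ a → h a , h∈⟨ys⟩ a)
  corestrict-isEmbedding _ = mkIsEmbedding K (FGSubgroup H _) _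
    h.⟦⟧-cong h.∙-homo h.ε-homo h.⁻¹-homo h.injective

module _ (G : Group c ℓ) {xs ys : List (Group.Carrier G)} (xs⊆ys : xs ⊆ ys) where

  include : Group.Carrier (FGSubgroup G xs) → Group.Carrier (FGSubgroup G ys)
  include (x , p) = x , ⟨⟩-mono G xs⊆ys p

  include-isEmbedding : IsEmbedding (FGSubgroup G xs) (FGSubgroup G ys) include
  include-isEmbedding = corestrict-isEmbedding (FGSubgroup G xs) G (proj₁-isEmbedding G)
                          (λ a → ⟨⟩-mono G xs⊆ys (proj₂ a))

module _ (G : Group c₁ ℓ₁) (H : Group c₂ ℓ₂) {xs : List (Group.Carrier G)} where
  private
    module G = Group G
    module H = Group H
    K = FGSubgroup G xs

  imageGenerators : (Group.Carrier K → H.Carrier) → List H.Carrier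
  imageGenerators k = mapWith∈ xs (λ x∈xs → k (_ , gen x∈xs))

  module _ {k : Group.Carrier K → H.Carrier}
           (k-hom : IsGroupHomomorphism (Group.rawGroup K) (Group.rawGroup H) k) where
    private module k = IsGroupHomomorphism k-hom

    image⊆⟨imageGenerators⟩ : ∀ {x} (p : ⟨_⟩ G xs x) → ⟨_⟩ H (imageGenerators k) (k (x , p))
    image⊆⟨imageGenerators⟩ (gen x∈xs)   = gen (mapWith∈⁺ _ (_ , x∈xs , ≡.refl))
    image⊆⟨imageGenerators⟩ unit         = resp (H.sym k.ε-homo) unit
    image⊆⟨imageGenerators⟩ (inv p)      =
      resp (H.sym (k.⁻¹-homo (_ , p))) (inv (image⊆⟨imageGenerators⟩ p))
    image⊆⟨imageGenerators⟩ (mul p q)    =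
      resp (H.sym (k.homo (_ , p) (_ , q))) (mul (image⊆⟨imageGenerators⟩ p) (image⊆⟨imageGenerators⟩ q))
    image⊆⟨imageGenerators⟩ (resp x≈y p) = resp (k.⟦⟧-cong x≈y) (image⊆⟨imageGenerators⟩ p)

    ⟨imageGenerators⟩⊆image : ∀ {y} → ⟨_⟩ H (imageGenerators k) y → ∃ λ a → k a H.≈ y
    ⟨imageGenerators⟩⊆image (gen y∈gens) with mapWith∈⁻ xs _ y∈gens
    ... | x , x∈xs , y≡kx = (x , gen x∈xs) , H.reflexive (≡.sym y≡kx)
    ⟨imageGenerators⟩⊆image unit = (G.ε , unit) , k.ε-homo
    ⟨imageGenerators⟩⊆image (inv q) with ⟨imageGenerators⟩⊆image q
    ... | (x , p) , kx≈y = (x G.⁻¹ , inv p) , H.trans (k.⁻¹-homo (x , p)) (H.⁻¹-cong kx≈y)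
    ⟨imageGenerators⟩⊆image (mul q r) with ⟨imageGenerators⟩⊆image q | ⟨imageGenerators⟩⊆image r
    ... | (x , p) , kx≈y | (x′ , p′) , kx′≈y′ =
      (x G.∙ x′ , mul p p′) , H.trans (k.homo (x , p) (x′ , p′)) (H.∙-cong kx≈y kx′≈y′)
    ⟨imageGenerators⟩⊆image (resp y≈y′ q) with ⟨imageGenerators⟩⊆image q
    ... | a , ka≈y = a , H.trans ka≈y y≈y′

  module _ {k : Group.Carrier K → H.Carrier} (k-emb : IsEmbedding K H k) where
    private module k = IsGroupMonomorphism k-emb

    toImage : Group.Carrier K → Group.Carrier (FGSubgroup H (imageGenerators k))
    toImage a = k a , image⊆⟨imageGenerators⟩ k.isGroupHomomorphism (proj₂ a)

    toImage-isIsomorphism : IsIsomorphism K (FGSubgroup H (imageGenerators k)) toImage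
    toImage-isIsomorphism = record
      { isGroupMonomorphism = corestrict-isEmbedding K H k-emb _
      ; surjective = λ b → let (a , ka≈b) = ⟨imageGenerators⟩⊆image k.isGroupHomomorphism (proj₂ b)
                           in a , λ z≈a → H.trans (k.⟦⟧-cong z≈a) ka≈b
      }

module _ (G : Group c₁ ℓ₁) (H : Group c₂ ℓ₂) (homogeneous : Homogeneous H)
         {xs : List (Group.Carrier G)} where
  private
    module H = Group H
    K = FGSubgroup G xs

  embeddings-conjugate : ∀ {e f} → IsEmbedding K H e → IsEmbedding K H f →
    Σ[ α ∈ (H.Carrier → H.Carrier) ] (IsIsomorphism H H α × (∀ a → α (e a) H.≈ f a))
  embeddings-conjugate {e} {f} e-emb f-emb = α , α-iso , α∘e≈f
    where
    module f = IsGroupMonomorphism f-emb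
    E = FGSubgroup H (imageGenerators G H e)
    e-image-iso = toImage-isIsomorphism G H e-emb

    φ-iso : IsIsomorphism E (FGSubgroup H (imageGenerators G H f))
                          (toImage G H f-emb ∘ inverse K E e-image-iso)
    φ-iso = Compose.isGroupIsomorphism H.trans
              (inverse-isIsomorphism K E e-image-iso) (toImage-isIsomorphism G H f-emb)

    extension = proj₂ homogeneous _ _ _ φ-iso
    α = proj₁ extension
    α-iso = proj₁ (proj₂ extension)

    α∘e≈f : ∀ a → α (e a) H.≈ f a
    α∘e≈f a = H.trans (proj₂ (proj₂ extension) (toImage G H e-emb a))
                      (f.⟦⟧-cong (inverse-strictlyInverseʳ K E e-image-iso a))

  extend-embedding : ∀ {ys f} (xs⊆ys : xs ⊆ ys) → IsEmbedding K H f → Embeds (FGSubgroup G ys) H →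
    Σ[ F ∈ Embeds (FGSubgroup G ys) H ] (∀ a → proj₁ F (include G xs⊆ys a) H.≈ f a)
  extend-embedding xs⊆ys f-emb (e , e-emb) =
    let α , α-iso , α∘e≈f = embeddings-conjugate
                              (Compose.isGroupMonomorphism H.trans (include-isEmbedding G xs⊆ys) e-emb) f-emb
    in (α ∘ e , Compose.isGroupMonomorphism H.trans e-emb (IsGroupIsomorphism.isGroupMonomorphism α-iso))
       , α∘e≈f

module _ (G : Group c₁ ℓ₁) (H : Group c₂ ℓ₂)
         {L : ℕ → List (Group.Carrier G)} (L-⊆ : ∀ n → L n ⊆ L (suc n)) where
  private
    module G = Group G
    module H = Group H

  L-mono : ∀ {m n} → m ≤′ n → L m ⊆ L n
  L-mono ≤′-refl        = id
  L-mono (≤′-step m≤′n) = L-⊆ _ ∘ L-mono m≤′n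

  lift : ∀ {m n x} → m ≤′ n → ⟨_⟩ G (L m) x → ⟨_⟩ G (L n) x
  lift m≤′n = ⟨⟩-mono G (L-mono m≤′n)

  Compatible : (∀ n → Embeds (FGSubgroup G (L n)) H) → Set (c₁ Level.⊔ ℓ₁ Level.⊔ ℓ₂)
  Compatible F = ∀ n a → proj₁ (F (suc n)) (include G (L-⊆ n) a) H.≈ proj₁ (F n) a

  module _ (homogeneous : Homogeneous H) (embeds : ∀ n → Embeds (FGSubgroup G (L n)) H) where

    compatibleEmbeddings : ∀ n → Embeds (FGSubgroup G (L n)) H
    compatibleEmbeddings zero    = embeds zero
    compatibleEmbeddings (suc n) =
      proj₁ (extend-embedding G H homogeneous (L-⊆ n) (proj₂ (compatibleEmbeddings n)) (embeds (suc n)))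

    compatibleEmbeddings-compatible : Compatible compatibleEmbeddings
    compatibleEmbeddings-compatible n =
      proj₂ (extend-embedding G H homogeneous (L-⊆ n) (proj₂ (compatibleEmbeddings n)) (embeds (suc n)))

  module _ (exhaustive : ∀ g → ∃ λ n → ⟨_⟩ G (L n) g)
           (F : ∀ n → Embeds (FGSubgroup G (L n)) H) (F-compatible : Compatible F) where
    private
      module F n = IsGroupMonomorphism (proj₂ (F n))
      φ : ∀ n → Group.Carrier (FGSubgroup G (L n)) → H.Carrier
      φ n = proj₁ (F n)
      open SetoidReasoning H.setoid

    φ-coherent : ∀ {m n x} → m ≤′ n → (p : ⟨_⟩ G (L m) x) (q : ⟨_⟩ G (L n) x) →
                 φ n (x , q) H.≈ φ m (x , p)
    φ-coherent ≤′-refl p q = F.⟦⟧-cong _ G.refl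
    φ-coherent {m} {suc n} {x} (≤′-step m≤′n) p q = begin
      φ (suc n) (x , q)                        ≈⟨ F.⟦⟧-cong (suc n) G.refl ⟩
      φ (suc n) (include G (L-⊆ n) (x , p↑))  ≈⟨ F-compatible n (x , p↑) ⟩
      φ n (x , p↑)                             ≈⟨ φ-coherent m≤′n p p↑ ⟩
      φ m (x , p)                              ∎
      where p↑ = lift m≤′n p

    φ-agree : ∀ {m n x y} (p : ⟨_⟩ G (L m) x) (q : ⟨_⟩ G (L n) y) → x G.≈ y →
              φ m (x , p) H.≈ φ n (y , q)
    φ-agree {m} {n} {x} {y} p q x≈y = begin
      φ m (x , p)    ≈⟨ φ-coherent m≤′N p p↑ ⟨
      φ N (x , p↑)   ≈⟨ F.⟦⟧-cong N x≈y ⟩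
      φ N (y , q↑)   ≈⟨ φ-coherent n≤′N q q↑ ⟩
      φ n (y , q)    ∎
      where
      N = m ⊔ n
      m≤′N = ≤⇒≤′ (m≤m⊔n m n)
      n≤′N = ≤⇒≤′ (m≤n⊔m m n)
      p↑ = lift m≤′N p
      q↑ = lift n≤′N q

    commonLevel : ∀ g g′ → ∃ λ N → ⟨_⟩ G (L N) g × ⟨_⟩ G (L N) g′
    commonLevel g g′ =
      let m , p = exhaustive g; n , q = exhaustive g′
      in m ⊔ n , lift (≤⇒≤′ (m≤m⊔n m n)) p , lift (≤⇒≤′ (m≤n⊔m m n)) q

    union : G.Carrier → H.Carrier
    union g = φ (proj₁ (exhaustive g)) (g , proj₂ (exhaustive g))

    union-≈ : ∀ {n g} (p : ⟨_⟩ G (L n) g) → union g H.≈ φ n (g , p)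
    union-≈ p = φ-agree _ p G.refl

    union-isEmbedding : IsEmbedding G H union
    union-isEmbedding = mkIsEmbedding G H union
      (φ-agree _ _)
      (λ g g′ → let N , p , p′ = commonLevel g g′ in begin
        union (g G.∙ g′)                   ≈⟨ union-≈ (mul p p′) ⟩
        φ N (g G.∙ g′ , mul p p′)          ≈⟨ F.∙-homo N (g , p) (g′ , p′) ⟩
        φ N (g , p) H.∙ φ N (g′ , p′)      ≈⟨ H.∙-cong (union-≈ p) (union-≈ p′) ⟨
        union g H.∙ union g′               ∎)
      (H.trans (union-≈ {0} unit) (F.ε-homo 0))
      (λ g → H.trans (union-≈ (inv (proj₂ (exhaustive g)))) (F.⁻¹-homo _ _))
      (λ {g} {g′} ug≈ug′ → let N , p , p′ = commonLevel g g′ in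
        F.injective N (H.trans (H.sym (union-≈ p)) (H.trans ug≈ug′ (union-≈ p′))))

module _ (G : Group c ℓ) (countable : Countable G) where

  enumPrefix : ℕ → List (Group.Carrier G)
  enumPrefix zero    = []
  enumPrefix (suc n) = proj₁ countable n ∷ enumPrefix n

  enumPrefix-exhaustive : ∀ g → ∃ λ n → ⟨_⟩ G (enumPrefix n) g
  enumPrefix-exhaustive g =
    let n , enum-n≈g = proj₂ countable g in suc n , resp enum-n≈g (gen (here ≡.refl))

restrict : (G : Group c₁ ℓ₁) (H : Group c₂ ℓ₂) → Embeds G H →
           ∀ xs → Embeds (FGSubgroup G xs) H
restrict G H (f , f-emb) xs =
  f ∘ proj₁ , Compose.isGroupMonomorphism (Group.trans H) (proj₁-isEmbedding G) f-emb

mainTheorem18 : ∀ {c₁ ℓ₁ c₂ ℓ₂ : Level} (G : Group c₁ ℓ₁) (H : Group c₂ ℓ₂) →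
    Countable G → Homogeneous H →
    (Embeds G H ⇔ (∀ (xs : List (Group.Carrier G)) → Embeds (FGSubgroup G xs) H))
mainTheorem18 G H countable homogeneous = mk⇔ (restrict G H) λ fg-embeds →
  let L = enumPrefix G countable
      L-⊆ : ∀ n → L n ⊆ L (suc n)
      L-⊆ _ = there
      F = compatibleEmbeddings G H L-⊆ homogeneous (fg-embeds ∘ L)
      F-compatible = compatibleEmbeddings-compatible G H L-⊆ homogeneous (fg-embeds ∘ L)
      exhaustive = enumPrefix-exhaustive G countable
  in union G H L-⊆ exhaustive F F-compatible , union-isEmbedding G H L-⊆ exhaustive F F-compatible
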